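{- Let $n\ge 2$ and $k\ge 1$ be integers, let $\mathcal G\subset[n]^k$, and set $\alpha=|\mathcal G|/n^k$. Choose an ordered pair $(S_1,S_2)$ of disjoint tuples of $[n]^k$ uniformly at random among all such ordered pairs, and let $A_i$ be the event that $S_i\in\mathcal G$ ($i=1,2$). Then $$\big|\mathsf P[A_1\cap A_2]-\alpha^2\big|\le \frac{\alpha(1-\alpha)}{n-1}\quad\text{and}\quad \big|\mathsf P[\bar A_1\cap A_2]-\alpha(1-\alpha)\big|\le \frac{\alpha(1-\alpha)}{n-1}.$$
   Context: $[n]=\{1,\ldots,n\}$ and $[n]^k$ is the set of $k$-tuples with entries in $[n]$. Two tuples $(f_1,\ldots,f_k),(f'_1,\ldots,f'_k)\in[n]^k$ are disjoint if $f_i\ne f'_i$ for every $1\le i\le k$. $\bar A_1$ denotes the complement of the event $A_1$. -}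

module Defs where

open import Data.Nat using (ℕ; zero; suc)
open import Data.Integer using (+_)
open import Data.Rational using (ℚ; _/_; 0ℚ)
open import Data.Bool using (Bool; true; false; _∧_; not)
open import Data.Fin using (Fin; _≟_)
open import Data.Fin.Properties using ()
open import Data.Vec using (Vec; []; _∷_)
open import Data.List using (List; []; _∷_; [_]; map; concatMap; allFin; cartesianProduct; length; filter)
open import Data.Product using (_×_; _,_)
open import Relation.Nullary.Decidable using (⌊_⌋)

Tuple : ℕ → ℕ → Set
Tuple n k = Vec (Fin n) k

allTuples : (n k : ℕ) → List (Tuple n k)
allTuples n zero = [ [] ]
allTuples n (suc k) = concatMap (λ i → map (i ∷_) (allTuples n k)) (allFin n)

count : {A : Set} → (A → Bool) → List A → ℕ
count p [] = 0
count p (x ∷ xs) with p x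
... | true  = suc (count p xs)
... | false = count p xs

disjoint : {n k : ℕ} → Tuple n k → Tuple n k → Bool
disjoint [] [] = true
disjoint (x ∷ xs) (y ∷ ys) = not ⌊ x ≟ y ⌋ ∧ disjoint xs ys

disjointPairs : (n k : ℕ) → List (Tuple n k × Tuple n k)
disjointPairs n k =
  filter (λ { (s , t) → Data.Bool._≟_ (disjoint s t) true }) (cartesianProduct (allTuples n k) (allTuples n k))
  where import Data.Bool

-- the rational a / d (with the convention a / 0 = 0, never used when n ≥ 2)
ratio : ℕ → ℕ → ℚ
ratio a zero = 0ℚ
ratio a (suc d) = (+ a) / suc d

Pr : (n k : ℕ) → (Tuple n k × Tuple n k → Bool) → ℚ
Pr n k E = ratio (count E (disjointPairs n k)) (length (disjointPairs n k))

module Submission where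

-- Write N = nᵏ, P = (n-1)ᵏ, g for the indicator of 𝒢 and W for the disjointness matrix of [n]ᵏ
-- (W x y = 1 iff x and y are disjoint). There are P N disjoint ordered pairs, ⟨g, W g⟩ of them lie
-- in 𝒢 × 𝒢 and P |𝒢| - ⟨g, W g⟩ in 𝒢ᶜ × 𝒢, so both inequalities amount to
--   (n-1) |N ⟨g, W g⟩ - P |𝒢|²| ≤ P (N |𝒢| - |𝒢|²).
-- As W = (J - I)^⊗k, it has eigenvalue P on constants and eigenvalues of absolute value at most
-- (n-1)ᵏ⁻¹ on mean-zero functions; for the mean-zero function N g - |𝒢| this spectral gap is the
-- displayed bound. The gap is proved by induction on k without diagonalising W: a mean-zero h on
-- [n]ᵏ⁺¹ splits orthogonally into its marginal H = ∑ᵢ h(i, ·), the means cᵢ of uᵢ = n h(i, ·) - H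
-- and the doubly centred vᵢ = N uᵢ - cᵢ, on which the disjointness matrix of [n]ᵏ⁺¹ acts as
-- (n-1) W, as -P and as -W respectively.

-- The development lives in an anonymous module so that its integer operators do not clash with the
-- rational ones in the statement of proposition2.
module _ where

  open import Data.Bool as Bool using (Bool; true; false; _∧_; not)
  open import Data.Fin using (Fin; zero; suc; _≟_)
  open import Data.Integer as ℤ
    using (ℤ; +_; -[1+_]; 0ℤ; 1ℤ; -1ℤ; _+_; _-_; _*_; -_; ∣_∣; _≤_; _<_; +≤+)
  import Data.Integer.Properties as ℤ
  open import Data.Integer.Tactic.RingSolver using (solve-∀)
  open import Data.List
    using (List; []; _∷_; _++_; map; concatMap; allFin; length; filter; cartesianProduct)
  import Data.List.Properties as List
  open import Data.Nat as ℕ using (ℕ; zero; suc; _^_)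
  import Data.Nat.Properties as ℕ
  open import Data.Product using (_×_; _,_)
  import Data.Rational as ℚ
  import Data.Rational.Properties as ℚ
  import Data.Rational.Unnormalised as ℚᵘ
  import Data.Rational.Unnormalised.Properties as ℚᵘ
  open import Data.Vec using ([]; _∷_)
  open import Function using (id)
  open import Level using (0ℓ)
  open import Relation.Binary.PropositionalEquality
    using (_≡_; refl; sym; trans; cong; cong₂; subst; module ≡-Reasoning)
  open import Relation.Nullary using (yes; no; does; contradiction)
  open import Relation.Nullary.Decidable using (⌊_⌋)
  open import Relation.Unary using (Pred; Decidable)

  open import Defs

  ∑ : {A : Set} → List A → (A → ℤ) → ℤ
  ∑ []       f = 0ℤ
  ∑ (x ∷ xs) f = f x + ∑ xs f

  syntax ∑ xs (λ x → e) = ∑[ x ∈ xs ] e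

  𝟙 : Bool → ℤ
  𝟙 true  = 1ℤ
  𝟙 false = 0ℤ

  module _ {A : Set} where

    ∑-cong : (xs : List A) {f g : A → ℤ} → (∀ x → f x ≡ g x) → ∑ xs f ≡ ∑ xs g
    ∑-cong []       f≗g = refl
    ∑-cong (x ∷ xs) f≗g = cong₂ _+_ (f≗g x) (∑-cong xs f≗g)

    ∑-distrib-+ : (xs : List A) (f g : A → ℤ) → ∑[ x ∈ xs ] (f x + g x) ≡ ∑ xs f + ∑ xs g
    ∑-distrib-+ []       f g = refl
    ∑-distrib-+ (x ∷ xs) f g =
      trans (cong (_+_ (f x + g x)) (∑-distrib-+ xs f g)) (interchange (f x) (g x) _ _)
      where
      interchange : ∀ a b c d → a + b + (c + d) ≡ a + c + (b + d)
      interchange = solve-∀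

    ∑-distrib-minus : (xs : List A) (f g : A → ℤ) → ∑[ x ∈ xs ] (f x - g x) ≡ ∑ xs f - ∑ xs g
    ∑-distrib-minus []       f g = refl
    ∑-distrib-minus (x ∷ xs) f g =
      trans (cong (_+_ (f x - g x)) (∑-distrib-minus xs f g)) (interchange (f x) (g x) _ _)
      where
      interchange : ∀ a b c d → a - b + (c - d) ≡ a + c - (b + d)
      interchange = solve-∀

    *-distribˡ-∑ : (xs : List A) (c : ℤ) (f : A → ℤ) → ∑[ x ∈ xs ] (c * f x) ≡ c * ∑ xs f
    *-distribˡ-∑ []       c f = sym (ℤ.*-zeroʳ c)
    *-distribˡ-∑ (x ∷ xs) c f =
      trans (cong (_+_ (c * f x)) (*-distribˡ-∑ xs c f)) (sym (ℤ.*-distribˡ-+ c (f x) _))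

    ∑-linear : (xs : List A) (c d : ℤ) (f g : A → ℤ) →
      ∑[ x ∈ xs ] (c * f x + d * g x) ≡ c * ∑ xs f + d * ∑ xs g
    ∑-linear xs c d f g =
      trans (∑-distrib-+ xs _ _) (cong₂ _+_ (*-distribˡ-∑ xs c f) (*-distribˡ-∑ xs d g))

    ∑-const : (xs : List A) (c : ℤ) → ∑[ _ ∈ xs ] c ≡ + length xs * c
    ∑-const []       c = refl
    ∑-const (x ∷ xs) c = trans (cong (_+_ c) (∑-const xs c)) (shuffle (+ length xs) c)
      where
      shuffle : ∀ l c → c + l * c ≡ (1ℤ + l) * c
      shuffle = solve-∀

    length-∑ : (xs : List A) → + length xs ≡ ∑[ _ ∈ xs ] 1ℤ
    length-∑ xs = sym (trans (∑-const xs 1ℤ) (ℤ.*-identityʳ _))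

    ∑-centred : (xs : List A) (u : A → ℤ) → ∑[ x ∈ xs ] (+ length xs * u x - ∑ xs u) ≡ 0ℤ
    ∑-centred xs u = begin
      ∑[ x ∈ xs ] (+ length xs * u x - ∑ xs u)
        ≡⟨ ∑-distrib-minus xs _ _ ⟩
      ∑[ x ∈ xs ] (+ length xs * u x) - ∑[ _ ∈ xs ] ∑ xs u
        ≡⟨ cong₂ _-_ (*-distribˡ-∑ xs (+ length xs) u) (∑-const xs (∑ xs u)) ⟩
      + length xs * ∑ xs u - + length xs * ∑ xs u
        ≡⟨ ℤ.+-inverseʳ (+ length xs * ∑ xs u) ⟩
      0ℤ
        ∎
      where open ≡-Reasoning

    ∑-mono-≤ : (xs : List A) {f g : A → ℤ} → (∀ x → f x ≤ g x) → ∑ xs f ≤ ∑ xs g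
    ∑-mono-≤ []       f≤g = ℤ.≤-refl
    ∑-mono-≤ (x ∷ xs) f≤g = ℤ.+-mono-≤ (f≤g x) (∑-mono-≤ xs f≤g)

    ∑-nonNeg : (xs : List A) {f : A → ℤ} → (∀ x → 0ℤ ≤ f x) → 0ℤ ≤ ∑ xs f
    ∑-nonNeg []       0≤f = ℤ.≤-refl
    ∑-nonNeg (x ∷ xs) 0≤f = ℤ.+-mono-≤ (0≤f x) (∑-nonNeg xs 0≤f)

    ∑-++ : (xs ys : List A) (f : A → ℤ) → ∑ (xs ++ ys) f ≡ ∑ xs f + ∑ ys f
    ∑-++ []       ys f = sym (ℤ.+-identityˡ _)
    ∑-++ (x ∷ xs) ys f = trans (cong (_+_ (f x)) (∑-++ xs ys f)) (sym (ℤ.+-assoc (f x) _ _))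

    ∑-filter : {P : Pred A 0ℓ} (P? : Decidable P) (xs : List A) (f : A → ℤ) →
      ∑ (filter P? xs) f ≡ ∑[ x ∈ xs ] (𝟙 (does (P? x)) * f x)
    ∑-filter P? []       f = refl
    ∑-filter P? (x ∷ xs) f with does (P? x)
    ... | true  = cong₂ _+_ (sym (ℤ.*-identityˡ (f x))) (∑-filter P? xs f)
    ... | false = trans (∑-filter P? xs f) (sym (ℤ.+-identityˡ _))

    count-∑ : (p : A → Bool) (xs : List A) → + count p xs ≡ ∑[ x ∈ xs ] 𝟙 (p x)
    count-∑ p []       = refl
    count-∑ p (x ∷ xs) with p x
    ... | true  = cong (_+_ 1ℤ) (count-∑ p xs)
    ... | false = trans (count-∑ p xs) (sym (ℤ.+-identityˡ _))

  module _ {A B : Set} where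

    ∑-map : (g : A → B) (xs : List A) (f : B → ℤ) → ∑ (map g xs) f ≡ ∑[ x ∈ xs ] f (g x)
    ∑-map g []       f = refl
    ∑-map g (x ∷ xs) f = cong (_+_ (f (g x))) (∑-map g xs f)

    ∑-concatMap : (g : A → List B) (xs : List A) (f : B → ℤ) →
      ∑ (concatMap g xs) f ≡ ∑[ x ∈ xs ] ∑ (g x) f
    ∑-concatMap g []       f = refl
    ∑-concatMap g (x ∷ xs) f =
      trans (∑-++ (g x) (concatMap g xs) f) (cong (_+_ (∑ (g x) f)) (∑-concatMap g xs f))

    ∑-comm : (xs : List A) (ys : List B) (f : A → B → ℤ) →
      ∑[ x ∈ xs ] ∑[ y ∈ ys ] f x y ≡ ∑[ y ∈ ys ] ∑[ x ∈ xs ] f x y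
    ∑-comm []       ys f = sym (trans (∑-const ys 0ℤ) (ℤ.*-zeroʳ (+ length ys)))
    ∑-comm (x ∷ xs) ys f =
      trans (cong (_+_ (∑ ys (f x))) (∑-comm xs ys f)) (sym (∑-distrib-+ ys (f x) _))

  ∑-cartesianProduct : {A B : Set} (xs : List A) (ys : List B) (f : A × B → ℤ) →
    ∑ (cartesianProduct xs ys) f ≡ ∑[ x ∈ xs ] ∑[ y ∈ ys ] f (x , y)
  ∑-cartesianProduct []       ys f = refl
  ∑-cartesianProduct (x ∷ xs) ys f = trans (∑-++ (map (x ,_) ys) _ f)
    (cong₂ _+_ (∑-map (x ,_) ys f) (∑-cartesianProduct xs ys f))

  length-allFin : ∀ n → length (allFin n) ≡ n
  length-allFin n = List.length-tabulate id

  ∑-allFin-suc : (n : ℕ) (f : Fin (suc n) → ℤ) →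
    ∑ (allFin (suc n)) f ≡ f zero + ∑[ i ∈ allFin n ] f (suc i)
  ∑-allFin-suc n f = cong (_+_ (f zero))
    (trans (cong (λ is → ∑ is f) (sym (List.map-tabulate id suc))) (∑-map suc (allFin n) f))

  ∣_∣ᶻ : ℤ → ℤ
  ∣ i ∣ᶻ = + ∣ i ∣

  ∣i+j∣ᶻ≤∣i∣ᶻ+∣j∣ᶻ : ∀ i j → ∣ i + j ∣ᶻ ≤ ∣ i ∣ᶻ + ∣ j ∣ᶻ
  ∣i+j∣ᶻ≤∣i∣ᶻ+∣j∣ᶻ i j = +≤+ (ℤ.∣i+j∣≤∣i∣+∣j∣ i j)

  ∣i-j∣ᶻ≤∣i∣ᶻ+∣j∣ᶻ : ∀ i j → ∣ i - j ∣ᶻ ≤ ∣ i ∣ᶻ + ∣ j ∣ᶻ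
  ∣i-j∣ᶻ≤∣i∣ᶻ+∣j∣ᶻ i j = +≤+ (ℤ.∣i-j∣≤∣i∣+∣j∣ i j)

  ∣i*j∣ᶻ≡i*∣j∣ᶻ : ∀ {i} j → 0ℤ ≤ i → ∣ i * j ∣ᶻ ≡ i * ∣ j ∣ᶻ
  ∣i*j∣ᶻ≡i*∣j∣ᶻ {+ m} j _ = trans (cong +_ (ℤ.abs-* (+ m) j)) (ℤ.pos-* m ∣ j ∣)

  ∣∑∣ᶻ≤∑∣∣ᶻ : {A : Set} (xs : List A) (f : A → ℤ) → ∣ ∑ xs f ∣ᶻ ≤ ∑[ x ∈ xs ] ∣ f x ∣ᶻ
  ∣∑∣ᶻ≤∑∣∣ᶻ []       f = ℤ.≤-refl
  ∣∑∣ᶻ≤∑∣∣ᶻ (x ∷ xs) f =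
    ℤ.≤-trans (∣i+j∣ᶻ≤∣i∣ᶻ+∣j∣ᶻ (f x) _) (ℤ.+-monoʳ-≤ ∣ f x ∣ᶻ (∣∑∣ᶻ≤∑∣∣ᶻ xs f))

  ∣a*x-b-∑∣ᶻ≤ : {I : Set} (is : List I) {a b : ℤ} → 0ℤ ≤ a → 0ℤ ≤ b → ∀ x (f : I → ℤ) →
    ∣ a * x - b - ∑ is f ∣ᶻ ≤ a * ∣ x ∣ᶻ + b + ∑[ i ∈ is ] ∣ f i ∣ᶻ
  ∣a*x-b-∑∣ᶻ≤ is {a} {b} 0≤a 0≤b x f = begin
    ∣ a * x - b - ∑ is f ∣ᶻ
      ≤⟨ ∣i-j∣ᶻ≤∣i∣ᶻ+∣j∣ᶻ (a * x - b) (∑ is f) ⟩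
    ∣ a * x - b ∣ᶻ + ∣ ∑ is f ∣ᶻ
      ≤⟨ ℤ.+-mono-≤ (∣i-j∣ᶻ≤∣i∣ᶻ+∣j∣ᶻ (a * x) b) (∣∑∣ᶻ≤∑∣∣ᶻ is f) ⟩
    ∣ a * x ∣ᶻ + ∣ b ∣ᶻ + ∑[ i ∈ is ] ∣ f i ∣ᶻ
      ≡⟨ cong₂ (λ p q → p + q + ∑[ i ∈ is ] ∣ f i ∣ᶻ) (∣i*j∣ᶻ≡i*∣j∣ᶻ x 0≤a) (ℤ.0≤i⇒+∣i∣≡i 0≤b) ⟩
    a * ∣ x ∣ᶻ + b + ∑[ i ∈ is ] ∣ f i ∣ᶻ
      ∎
    where open ℤ.≤-Reasoning

  0≤+ : ∀ a → 0ℤ ≤ + a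
  0≤+ a = +≤+ ℕ.z≤n

  0≤i*j : ∀ {i j} → 0ℤ ≤ i → 0ℤ ≤ j → 0ℤ ≤ i * j
  0≤i*j {+ a} {+ b} _ _ = subst (0ℤ ≤_) (ℤ.pos-* a b) (0≤+ (a ℕ.* b))

  0<i*j : ∀ {i j} → 0ℤ < i → 0ℤ < j → 0ℤ < i * j
  0<i*j (ℤ.+<+ (ℕ.s≤s _)) (ℤ.+<+ (ℕ.s≤s _)) = ℤ.+<+ (ℕ.s≤s ℕ.z≤n)

  0≤i*i : ∀ i → 0ℤ ≤ i * i
  0≤i*i (+ a)    = 0≤i*j {+ a} {+ a} (0≤+ a) (0≤+ a)
  0≤i*i -[1+ a ] = 0≤+ _

  record IsLinear {A : Set} (L : (A → ℤ) → ℤ) : Set where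
    field
      L-cong : ∀ {f g} → (∀ x → f x ≡ g x) → L f ≡ L g
      linear : ∀ c d f g → L (λ x → c * f x + d * g x) ≡ c * L f + d * L g

    L-∑ : {I : Set} (is : List I) (f : I → A → ℤ) → L (λ x → ∑[ i ∈ is ] f i x) ≡ ∑[ i ∈ is ] L (f i)
    L-∑ []       f = begin
      L (λ _ → 0ℤ)                            ≡⟨ L-cong (λ _ → sym (ℤ.*-zeroˡ (0ℤ + 0ℤ))) ⟩
      L (λ _ → 0ℤ * 0ℤ + 0ℤ * 0ℤ)             ≡⟨ linear 0ℤ 0ℤ (λ _ → 0ℤ) (λ _ → 0ℤ) ⟩
      0ℤ * L (λ _ → 0ℤ) + 0ℤ * L (λ _ → 0ℤ)   ≡⟨ ℤ.*-zeroˡ (L (λ _ → 0ℤ) + L (λ _ → 0ℤ)) ⟩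
      0ℤ                                      ∎
      where open ≡-Reasoning
    L-∑ (i ∷ is) f = begin
      L (λ x → f i x + ∑[ j ∈ is ] f j x)               ≡⟨ L-cong (λ x → sym (ones (f i x) _)) ⟩
      L (λ x → 1ℤ * f i x + 1ℤ * ∑[ j ∈ is ] f j x)     ≡⟨ linear 1ℤ 1ℤ (f i) _ ⟩
      1ℤ * L (f i) + 1ℤ * L (λ x → ∑[ j ∈ is ] f j x)   ≡⟨ ones (L (f i)) _ ⟩
      L (f i) + L (λ x → ∑[ j ∈ is ] f j x)             ≡⟨ cong (_+_ (L (f i))) (L-∑ is f) ⟩
      L (f i) + ∑[ j ∈ is ] L (f j)                     ∎
      where
      open ≡-Reasoning
      ones : ∀ a b → 1ℤ * a + 1ℤ * b ≡ a + b
      ones = solve-∀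

  record IsBilinear {A : Set} (β : (A → ℤ) → (A → ℤ) → ℤ) : Set where
    field
      linearˡ : ∀ g → IsLinear (λ f → β f g)
      linearʳ : ∀ f → IsLinear (β f)

    open IsLinear

    β-cong : ∀ {f f′ g g′} → (∀ x → f x ≡ f′ x) → (∀ x → g x ≡ g′ x) → β f g ≡ β f′ g′
    β-cong {f′ = f′} {g = g} f≗f′ g≗g′ = trans (L-cong (linearˡ g) f≗f′) (L-cong (linearʳ f′) g≗g′)

    expand : ∀ c d f g → β (λ x → c * f x + d * g x) (λ x → c * f x + d * g x)
                       ≡ c * c * β f f + c * d * (β f g + β g f) + d * d * β g g
    expand c d f g = begin
      β φ φ
        ≡⟨ linear (linearˡ φ) c d f g ⟩
      c * β f φ + d * β g φ
        ≡⟨ cong₂ (λ a b → c * a + d * b) (linear (linearʳ f) c d f g) (linear (linearʳ g) c d f g) ⟩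
      c * (c * β f f + d * β f g) + d * (c * β g f + d * β g g)
        ≡⟨ regroup c d (β f f) (β f g) (β g f) (β g g) ⟩
      c * c * β f f + c * d * (β f g + β g f) + d * d * β g g
        ∎
      where
      open ≡-Reasoning
      φ = λ x → c * f x + d * g x
      regroup : ∀ c d a b b′ e → c * (c * a + d * b) + d * (c * b′ + d * e)
                               ≡ c * c * a + c * d * (b + b′) + d * d * e
      regroup = solve-∀

    centre-family : {I : Set} (is : List I) (f : I → A → ℤ) →
      let ℓ = + length is ; F = λ x → ∑[ i ∈ is ] f i x in
      ∑[ i ∈ is ] β (λ x → ℓ * f i x - F x) (λ x → ℓ * f i x - F x)
        ≡ ℓ * ℓ * ∑[ i ∈ is ] β (f i) (f i) - ℓ * β F F
    centre-family is f = begin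
      ∑[ i ∈ is ] β (λ x → ℓ * f i x - F x) (λ x → ℓ * f i x - F x)
        ≡⟨ ∑-cong is (λ i → trans (β-cong (λ x → minus (f i x) (F x)) (λ x → minus (f i x) (F x)))
                                  (expand ℓ -1ℤ (f i) F)) ⟩
      ∑[ i ∈ is ] (ℓ * ℓ * β (f i) (f i) + ℓ * -1ℤ * (β (f i) F + β F (f i)) + -1ℤ * -1ℤ * β F F)
        ≡⟨ trans (∑-distrib-+ is _ _) (cong₂ _+_ (∑-linear is (ℓ * ℓ) (ℓ * -1ℤ) _ _) (∑-const is _)) ⟩
      ℓ * ℓ * ∑[ i ∈ is ] β (f i) (f i) + ℓ * -1ℤ * ∑[ i ∈ is ] (β (f i) F + β F (f i))
        + + length is * (-1ℤ * -1ℤ * β F F)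
        ≡⟨ cong (λ s → ℓ * ℓ * ∑[ i ∈ is ] β (f i) (f i) + ℓ * -1ℤ * s + ℓ * (-1ℤ * -1ℤ * β F F))
                (trans (∑-distrib-+ is _ _)
                       (cong₂ _+_ (sym (L-∑ (linearˡ F) is f)) (sym (L-∑ (linearʳ F) is f)))) ⟩
      ℓ * ℓ * ∑[ i ∈ is ] β (f i) (f i) + ℓ * -1ℤ * (β F F + β F F) + ℓ * (-1ℤ * -1ℤ * β F F)
        ≡⟨ collect ℓ (∑[ i ∈ is ] β (f i) (f i)) (β F F) ⟩
      ℓ * ℓ * ∑[ i ∈ is ] β (f i) (f i) - ℓ * β F F
        ∎
      where
      open ≡-Reasoning
      ℓ = + length is
      F = λ x → ∑[ i ∈ is ] f i x
      minus : ∀ a b → ℓ * a - b ≡ ℓ * a + -1ℤ * b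
      minus a b = cong (_+_ (ℓ * a)) (sym (ℤ.-1*i≡-i b))
      collect : ∀ ℓ s b → ℓ * ℓ * s + ℓ * -1ℤ * (b + b) + ℓ * (-1ℤ * -1ℤ * b) ≡ ℓ * ℓ * s - ℓ * b
      collect = solve-∀

    centre-constant : (xs : List A) (r : ℤ) →
      (∀ f → β (λ _ → 1ℤ) f ≡ r * ∑ xs f) → (∀ f → β f (λ _ → 1ℤ) ≡ r * ∑ xs f) →
      ∀ u → let N = + length xs ; s = ∑ xs u in
      β (λ x → N * u x - s) (λ x → N * u x - s) ≡ N * N * β u u - r * N * (s * s)
    centre-constant xs r β-1ˡ β-1ʳ u = begin
      β (λ x → N * u x - s) (λ x → N * u x - s)
        ≡⟨ β-cong (λ x → shift (N * u x)) (λ x → shift (N * u x)) ⟩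
      β (λ x → N * u x + - s * 1ℤ) (λ x → N * u x + - s * 1ℤ)
        ≡⟨ expand N (- s) u 1̂ ⟩
      N * N * β u u + N * - s * (β u 1̂ + β 1̂ u) + - s * - s * β 1̂ 1̂
        ≡⟨ cong₂ (λ a b → N * N * β u u + N * - s * a + - s * - s * b)
                 (cong₂ _+_ (β-1ʳ u) (β-1ˡ u)) (trans (β-1ˡ 1̂) (cong (r *_) (∑-const xs 1ℤ))) ⟩
      N * N * β u u + N * - s * (r * s + r * s) + - s * - s * (r * (N * 1ℤ))
        ≡⟨ collect N s r (β u u) ⟩
      N * N * β u u - r * N * (s * s)
        ∎
      where
      open ≡-Reasoning
      N = + length xs
      s = ∑ xs u
      1̂ : A → ℤ
      1̂ _ = 1ℤ
      shift : ∀ a → a - s ≡ a + - s * 1ℤ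
      shift a = cong (_+_ a) (sym (ℤ.*-identityʳ (- s)))
      collect : ∀ N s r b → N * N * b + N * - s * (r * s + r * s) + - s * - s * (r * (N * 1ℤ))
                          ≡ N * N * b - r * N * (s * s)
      collect = solve-∀

    decomposition : {I : Set} (is : List I) (xs : List A) (r : ℤ) →
      (∀ f → β (λ _ → 1ℤ) f ≡ r * ∑ xs f) → (∀ f → β f (λ _ → 1ℤ) ≡ r * ∑ xs f) →
      (f : I → A → ℤ) →
      let ℓ = + length is ; N = + length xs
          F = λ x → ∑[ i ∈ is ] f i x
          u = λ i x → ℓ * f i x - F x
          v = λ i x → N * u i x - ∑ xs (u i) in
      ℓ * ℓ * (N * N) * ∑[ i ∈ is ] β (f i) (f i)
        ≡ N * N * ℓ * β F F + r * N * ∑[ i ∈ is ] (∑ xs (u i) * ∑ xs (u i)) + ∑[ i ∈ is ] β (v i) (v i)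
    decomposition is xs r β-1ˡ β-1ʳ f = begin
      ℓ * ℓ * (N * N) * Σff
        ≡⟨ regroup ℓ N r Σff (β F F) C ⟩
      N * N * ℓ * β F F + r * N * C + (N * N * (ℓ * ℓ * Σff - ℓ * β F F) - r * N * C)
        ≡⟨ cong (λ z → N * N * ℓ * β F F + r * N * C + (N * N * z - r * N * C)) (centre-family is f) ⟨
      N * N * ℓ * β F F + r * N * C + (N * N * Σuu - r * N * C)
        ≡⟨ cong (_+_ (N * N * ℓ * β F F + r * N * C)) Σvv ⟨
      N * N * ℓ * β F F + r * N * C + ∑[ i ∈ is ] β (v i) (v i)
        ∎
      where
      open ≡-Reasoning
      ℓ = + length is
      N = + length xs
      F = λ x → ∑[ i ∈ is ] f i x
      u = λ i x → ℓ * f i x - F x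
      c = λ i → ∑ xs (u i)
      v = λ i x → N * u i x - c i
      Σff = ∑[ i ∈ is ] β (f i) (f i)
      Σuu = ∑[ i ∈ is ] β (u i) (u i)
      C = ∑[ i ∈ is ] (c i * c i)
      Σvv : ∑[ i ∈ is ] β (v i) (v i) ≡ N * N * Σuu - r * N * C
      Σvv = begin
        ∑[ i ∈ is ] β (v i) (v i)
          ≡⟨ ∑-cong is (λ i → centre-constant xs r β-1ˡ β-1ʳ (u i)) ⟩
        ∑[ i ∈ is ] (N * N * β (u i) (u i) - r * N * (c i * c i))
          ≡⟨ ∑-distrib-minus is _ _ ⟩
        ∑[ i ∈ is ] (N * N * β (u i) (u i)) - ∑[ i ∈ is ] (r * N * (c i * c i))
          ≡⟨ cong₂ _-_ (*-distribˡ-∑ is (N * N) _) (*-distribˡ-∑ is (r * N) _) ⟩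
        N * N * Σuu - r * N * C
          ∎
      regroup : ∀ ℓ N r a b C → ℓ * ℓ * (N * N) * a
                              ≡ N * N * ℓ * b + r * N * C + (N * N * (ℓ * ℓ * a - ℓ * b) - r * N * C)
      regroup = solve-∀

  𝟙-∧ : ∀ a b → 𝟙 (a ∧ b) ≡ 𝟙 a * 𝟙 b
  𝟙-∧ true  b = sym (ℤ.*-identityˡ (𝟙 b))
  𝟙-∧ false b = refl

  ≟-sym : ∀ {n} (i j : Fin n) → ⌊ i ≟ j ⌋ ≡ ⌊ j ≟ i ⌋
  ≟-sym i j with i ≟ j | j ≟ i
  ... | yes _   | yes _   = refl
  ... | no _    | no _    = refl
  ... | yes i≡j | no j≢i  = contradiction (sym i≡j) j≢i
  ... | no i≢j  | yes j≡i = contradiction (sym j≡i) i≢j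

  ≟-suc : ∀ {n} (i j : Fin n) → ⌊ suc i ≟ suc j ⌋ ≡ ⌊ i ≟ j ⌋
  ≟-suc i j with i ≟ j
  ... | yes _ = refl
  ... | no _  = refl

  disjoint-sym : ∀ {n k} (x y : Tuple n k) → disjoint x y ≡ disjoint y x
  disjoint-sym []      []      = refl
  disjoint-sym (i ∷ x) (j ∷ y) = cong₂ (λ a b → not a ∧ b) (≟-sym i j) (disjoint-sym x y)

  ∑-≢ : ∀ {n} (i : Fin n) (f : Fin n → ℤ) →
    ∑[ j ∈ allFin n ] (𝟙 (not ⌊ i ≟ j ⌋) * f j) ≡ ∑ (allFin n) f - f i
  ∑-≢ {suc n} zero f = begin
    ∑[ j ∈ allFin (suc n) ] (𝟙 (not ⌊ zero ≟ j ⌋) * f j)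
      ≡⟨ ∑-allFin-suc n (λ j → 𝟙 (not ⌊ zero ≟ j ⌋) * f j) ⟩
    0ℤ + ∑[ j ∈ allFin n ] (1ℤ * f (suc j))
      ≡⟨ cong (_+_ 0ℤ) (∑-cong (allFin n) (λ j → ℤ.*-identityˡ (f (suc j)))) ⟩
    0ℤ + ∑[ j ∈ allFin n ] f (suc j)
      ≡⟨ add-sub (f zero) _ ⟩
    f zero + ∑[ j ∈ allFin n ] f (suc j) - f zero
      ≡⟨ cong (_- f zero) (∑-allFin-suc n f) ⟨
    ∑ (allFin (suc n)) f - f zero
      ∎
    where
    open ≡-Reasoning
    add-sub : ∀ a b → 0ℤ + b ≡ a + b - a
    add-sub = solve-∀
  ∑-≢ {suc n} (suc i) f = begin
    ∑[ j ∈ allFin (suc n) ] (𝟙 (not ⌊ suc i ≟ j ⌋) * f j)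
      ≡⟨ ∑-allFin-suc n (λ j → 𝟙 (not ⌊ suc i ≟ j ⌋) * f j) ⟩
    1ℤ * f zero + ∑[ j ∈ allFin n ] (𝟙 (not ⌊ suc i ≟ suc j ⌋) * f (suc j))
      ≡⟨ cong (_+_ (1ℤ * f zero))
              (∑-cong (allFin n) (λ j → cong (λ b → 𝟙 (not b) * f (suc j)) (≟-suc i j))) ⟩
    1ℤ * f zero + ∑[ j ∈ allFin n ] (𝟙 (not ⌊ i ≟ j ⌋) * f (suc j))
      ≡⟨ cong (_+_ (1ℤ * f zero)) (∑-≢ i (λ j → f (suc j))) ⟩
    1ℤ * f zero + (∑[ j ∈ allFin n ] f (suc j) - f (suc i))
      ≡⟨ reassoc (f zero) _ _ ⟩
    f zero + ∑[ j ∈ allFin n ] f (suc j) - f (suc i)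
      ≡⟨ cong (_- f (suc i)) (∑-allFin-suc n f) ⟨
    ∑ (allFin (suc n)) f - f (suc i)
      ∎
    where
    open ≡-Reasoning
    reassoc : ∀ a b c → 1ℤ * a + (b - c) ≡ a + b - c
    reassoc = solve-∀

  module Forms (n : ℕ) where

    Fun : ℕ → Set
    Fun k = Tuple n k → ℤ

    ∑ᵀ : ∀ {k} → Fun k → ℤ
    ∑ᵀ {k} = ∑ (allTuples n k)

    ⟪_,_⟫ : ∀ {k} → Fun k → Fun k → ℤ
    ⟪ f , g ⟫ = ∑ᵀ (λ x → f x * g x)

    ⟪_,W_⟫ : ∀ {k} → Fun k → Fun k → ℤ
    ⟪ f ,W g ⟫ = ∑ᵀ (λ x → ∑ᵀ (λ y → 𝟙 (disjoint x y) * (f x * g y)))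

    slice : ∀ {k} → Fun (suc k) → Fin n → Fun k
    slice f i x = f (i ∷ x)

    marginal : ∀ {k} → Fun (suc k) → Fun k
    marginal f x = ∑[ i ∈ allFin n ] f (i ∷ x)

    ∑ᵀ-suc : ∀ {k} (f : Fun (suc k)) → ∑ᵀ f ≡ ∑[ i ∈ allFin n ] ∑ᵀ (slice f i)
    ∑ᵀ-suc {k} f =
      trans (∑-concatMap _ (allFin n) f) (∑-cong (allFin n) (λ i → ∑-map (i ∷_) (allTuples n k) f))

    ∑ᵀ-marginal : ∀ {k} (f : Fun (suc k)) → ∑ᵀ f ≡ ∑ᵀ (marginal f)
    ∑ᵀ-marginal {k} f = trans (∑ᵀ-suc f) (∑-comm (allFin n) (allTuples n k) (λ i x → f (i ∷ x)))

    ∑ᵀ-ones : ∀ k → ∑ᵀ {k} (λ _ → 1ℤ) ≡ + (n ^ k)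
    ∑ᵀ-ones zero    = refl
    ∑ᵀ-ones (suc k) = begin
      ∑ᵀ {suc k} (λ _ → 1ℤ)                 ≡⟨ ∑ᵀ-suc _ ⟩
      ∑[ _ ∈ allFin n ] ∑ᵀ {k} (λ _ → 1ℤ)   ≡⟨ ∑-cong (allFin n) (λ _ → ∑ᵀ-ones k) ⟩
      ∑[ _ ∈ allFin n ] (+ (n ^ k))         ≡⟨ ∑-const (allFin n) (+ (n ^ k)) ⟩
      + length (allFin n) * + (n ^ k)       ≡⟨ cong (λ l → + l * + (n ^ k)) (length-allFin n) ⟩
      + n * + (n ^ k)                       ≡⟨ ℤ.pos-* n (n ^ k) ⟨
      + (n ^ suc k)                         ∎
      where open ≡-Reasoning

    length-allTuples : ∀ k → + length (allTuples n k) ≡ + (n ^ k)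
    length-allTuples k = trans (length-∑ (allTuples n k)) (∑ᵀ-ones k)

    ⟪,⟫-bilinear : ∀ {k} → IsBilinear (⟪_,_⟫ {k})
    ⟪,⟫-bilinear {k} = record
      { linearˡ = λ g → record
        { L-cong = λ f≗f′ → ∑-cong xs (λ x → cong (_* g x) (f≗f′ x))
        ; linear = λ c d f f′ →
            trans (∑-cong xs (λ x → distribʳ (f x) c (f′ x) d (g x))) (∑-linear xs c d _ _) }
      ; linearʳ = λ f → record
        { L-cong = λ g≗g′ → ∑-cong xs (λ x → cong (f x *_) (g≗g′ x))
        ; linear = λ c d g g′ →
            trans (∑-cong xs (λ x → distribˡ (f x) c (g x) d (g′ x))) (∑-linear xs c d _ _) } }
      where
      xs = allTuples n k
      distribʳ : ∀ a c a′ d b → (c * a + d * a′) * b ≡ c * (a * b) + d * (a′ * b)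
      distribʳ = solve-∀
      distribˡ : ∀ a c b d b′ → a * (c * b + d * b′) ≡ c * (a * b) + d * (a * b′)
      distribˡ = solve-∀

    ⟪,W⟫-bilinear : ∀ {k} → IsBilinear (⟪_,W_⟫ {k})
    ⟪,W⟫-bilinear {k} = record
      { linearˡ = λ g → record
        { L-cong = λ f≗f′ →
            ∑-cong xs (λ x → ∑-cong xs (λ y → cong (λ a → 𝟙 (disjoint x y) * (a * g y)) (f≗f′ x)))
        ; linear = λ c d f f′ → trans (∑-cong xs (λ x → trans
            (∑-cong xs (λ y → distribʳ (𝟙 (disjoint x y)) (f x) c (f′ x) d (g y))) (∑-linear xs c d _ _)))
            (∑-linear xs c d _ _) }
      ; linearʳ = λ f → record
        { L-cong = λ g≗g′ →
            ∑-cong xs (λ x → ∑-cong xs (λ y → cong (λ b → 𝟙 (disjoint x y) * (f x * b)) (g≗g′ y)))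
        ; linear = λ c d g g′ → trans (∑-cong xs (λ x → trans
            (∑-cong xs (λ y → distribˡ (𝟙 (disjoint x y)) (f x) c (g y) d (g′ y))) (∑-linear xs c d _ _)))
            (∑-linear xs c d _ _) } }
      where
      xs = allTuples n k
      distribʳ : ∀ w a c a′ d b → w * ((c * a + d * a′) * b) ≡ c * (w * (a * b)) + d * (w * (a′ * b))
      distribʳ = solve-∀
      distribˡ : ∀ w a c b d b′ → w * (a * (c * b + d * b′)) ≡ c * (w * (a * b)) + d * (w * (a * b′))
      distribˡ = solve-∀

    ⟪,W⟫-sym : ∀ {k} (f g : Fun k) → ⟪ f ,W g ⟫ ≡ ⟪ g ,W f ⟫
    ⟪,W⟫-sym {k} f g = trans (∑-comm xs xs _) (∑-cong xs (λ y → ∑-cong xs (λ x →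
      cong₂ _*_ (cong 𝟙 (disjoint-sym x y)) (ℤ.*-comm (f x) (g y)))))
      where xs = allTuples n k

    ⟪,⟫-nonNeg : ∀ {k} (f : Fun k) → 0ℤ ≤ ⟪ f , f ⟫
    ⟪,⟫-nonNeg {k} f = ∑-nonNeg (allTuples n k) (λ x → 0≤i*i (f x))

    ⟪,⟫-1ˡ : ∀ {k} (g : Fun k) → ⟪ (λ _ → 1ℤ) , g ⟫ ≡ 1ℤ * ∑ᵀ g
    ⟪,⟫-1ˡ {k} g = trans (∑-cong (allTuples n k) (λ x → ℤ.*-identityˡ (g x))) (sym (ℤ.*-identityˡ _))

    ⟪,⟫-1ʳ : ∀ {k} (f : Fun k) → ⟪ f , (λ _ → 1ℤ) ⟫ ≡ 1ℤ * ∑ᵀ f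
    ⟪,⟫-1ʳ {k} f = trans (∑-cong (allTuples n k) (λ x → ℤ.*-identityʳ (f x))) (sym (ℤ.*-identityˡ _))

    ⟪,⟫-slices : ∀ {k} (h : Fun (suc k)) → ⟪ h , h ⟫ ≡ ∑[ i ∈ allFin n ] ⟪ slice h i , slice h i ⟫
    ⟪,⟫-slices h = ∑ᵀ-suc (λ x → h x * h x)

    ⟪,W⟫-suc : ∀ {k} (f g : Fun (suc k)) →
      ⟪ f ,W g ⟫ ≡ ∑[ i ∈ allFin n ] ∑[ j ∈ allFin n ] (𝟙 (not ⌊ i ≟ j ⌋) * ⟪ slice f i ,W slice g j ⟫)
    ⟪,W⟫-suc {k} f g = begin
      ⟪ f ,W g ⟫
        ≡⟨ ∑ᵀ-suc _ ⟩
      ∑[ i ∈ is ] ∑ᵀ (λ x → ∑ᵀ (λ y → 𝟙 (disjoint (i ∷ x) y) * (f (i ∷ x) * g y)))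
        ≡⟨ ∑-cong is (λ i → ∑-cong xs (λ x → ∑ᵀ-suc _)) ⟩
      ∑[ i ∈ is ] ∑ᵀ (λ x → ∑[ j ∈ is ] ∑ᵀ (λ y → w i j x y))
        ≡⟨ ∑-cong is (λ i → ∑-comm xs is _) ⟩
      ∑[ i ∈ is ] ∑[ j ∈ is ] ∑ᵀ (λ x → ∑ᵀ (λ y → w i j x y))
        ≡⟨ ∑-cong is (λ i → ∑-cong is (λ j → factor i j)) ⟩
      ∑[ i ∈ is ] ∑[ j ∈ is ] (𝟙 (not ⌊ i ≟ j ⌋) * ⟪ slice f i ,W slice g j ⟫)
        ∎
      where
      open ≡-Reasoning
      is = allFin n
      xs = allTuples n k
      w : Fin n → Fin n → Tuple n k → Tuple n k → ℤ
      w i j x y = 𝟙 (disjoint (i ∷ x) (j ∷ y)) * (f (i ∷ x) * g (j ∷ y))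
      factor : ∀ i j → ∑ᵀ (λ x → ∑ᵀ (λ y → w i j x y)) ≡ 𝟙 (not ⌊ i ≟ j ⌋) * ⟪ slice f i ,W slice g j ⟫
      factor i j = trans (∑-cong xs (λ x → trans (∑-cong xs (λ y →
                     trans (cong (_* (f (i ∷ x) * g (j ∷ y))) (𝟙-∧ (not ⌊ i ≟ j ⌋) (disjoint x y)))
                           (ℤ.*-assoc (𝟙 (not ⌊ i ≟ j ⌋)) _ _)))
                     (*-distribˡ-∑ xs (𝟙 (not ⌊ i ≟ j ⌋)) _)))
                     (*-distribˡ-∑ xs (𝟙 (not ⌊ i ≟ j ⌋)) _)

    ⟪,W⟫-slices : ∀ {k} (h : Fun (suc k)) →
      ⟪ h ,W h ⟫ ≡ ⟪ marginal h ,W marginal h ⟫ - ∑[ i ∈ allFin n ] ⟪ slice h i ,W slice h i ⟫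
    ⟪,W⟫-slices h = begin
      ⟪ h ,W h ⟫
        ≡⟨ ⟪,W⟫-suc h h ⟩
      ∑[ i ∈ is ] ∑[ j ∈ is ] (𝟙 (not ⌊ i ≟ j ⌋) * ⟪ slice h i ,W slice h j ⟫)
        ≡⟨ ∑-cong is (λ i → ∑-≢ i (λ j → ⟪ slice h i ,W slice h j ⟫)) ⟩
      ∑[ i ∈ is ] (∑[ j ∈ is ] ⟪ slice h i ,W slice h j ⟫ - ⟪ slice h i ,W slice h i ⟫)
        ≡⟨ ∑-cong is (λ i → cong (_- ⟪ slice h i ,W slice h i ⟫) (L-∑ (linearʳ (slice h i)) is (slice h))) ⟨
      ∑[ i ∈ is ] (⟪ slice h i ,W marginal h ⟫ - ⟪ slice h i ,W slice h i ⟫)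
        ≡⟨ ∑-distrib-minus is _ _ ⟩
      ∑[ i ∈ is ] ⟪ slice h i ,W marginal h ⟫ - ∑[ i ∈ is ] ⟪ slice h i ,W slice h i ⟫
        ≡⟨ cong (_- ∑[ i ∈ is ] ⟪ slice h i ,W slice h i ⟫) (L-∑ (linearˡ (marginal h)) is (slice h)) ⟨
      ⟪ marginal h ,W marginal h ⟫ - ∑[ i ∈ is ] ⟪ slice h i ,W slice h i ⟫
        ∎
      where
      open ≡-Reasoning
      open IsBilinear ⟪,W⟫-bilinear
      open IsLinear
      is = allFin n

    ∑-disjointPairs : ∀ {k} (F : Tuple n k × Tuple n k → ℤ) →
      ∑ (disjointPairs n k) F ≡ ∑ᵀ (λ x → ∑ᵀ (λ y → 𝟙 (disjoint x y) * F (x , y)))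
    ∑-disjointPairs {k} F =
      trans (∑-filter _ (cartesianProduct xs xs) F) (trans (∑-cartesianProduct xs xs _)
            (∑-cong xs (λ x → ∑-cong xs (λ y → cong (_* F (x , y)) (𝟙-does-≟true (disjoint x y))))))
      where
      xs = allTuples n k
      𝟙-does-≟true : ∀ b → 𝟙 (does (b Bool.≟ true)) ≡ 𝟙 b
      𝟙-does-≟true true  = refl
      𝟙-does-≟true false = refl

    count-disjointPairs : ∀ {k} (E : Tuple n k × Tuple n k → Bool) (f g : Fun k) →
      (∀ x y → 𝟙 (E (x , y)) ≡ f x * g y) → + count E (disjointPairs n k) ≡ ⟪ f ,W g ⟫
    count-disjointPairs {k} E f g E≡fg = trans (count-∑ E (disjointPairs n k))
      (trans (∑-disjointPairs (λ xy → 𝟙 (E xy)))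
             (∑-cong xs (λ x → ∑-cong xs (λ y → cong (𝟙 (disjoint x y) *_) (E≡fg x y)))))
      where xs = allTuples n k

  module SpectralGap (m : ℕ) .{{_ : ℕ.NonZero m}} where

    open Forms (suc m)

    M : ℤ
    M = + m

    P : ℕ → ℤ
    P k = + (m ^ k)

    disjoint-degree : ∀ {k} (x : Tuple (suc m) k) → ∑ᵀ (λ y → 𝟙 (disjoint x y)) ≡ P k
    disjoint-degree []              = refl
    disjoint-degree {suc k} (i ∷ x) = begin
      ∑ᵀ (λ y → 𝟙 (disjoint (i ∷ x) y))
        ≡⟨ ∑ᵀ-suc {k} (λ y → 𝟙 (disjoint (i ∷ x) y)) ⟩
      ∑[ j ∈ is ] ∑ᵀ (λ y → 𝟙 (not ⌊ i ≟ j ⌋ ∧ disjoint x y))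
        ≡⟨ ∑-cong is (λ j → trans (∑-cong xs (λ y → 𝟙-∧ (not ⌊ i ≟ j ⌋) (disjoint x y)))
                                  (*-distribˡ-∑ xs (𝟙 (not ⌊ i ≟ j ⌋)) _)) ⟩
      ∑[ j ∈ is ] (𝟙 (not ⌊ i ≟ j ⌋) * ∑ᵀ (λ y → 𝟙 (disjoint x y)))
        ≡⟨ ∑-cong is (λ j → cong (𝟙 (not ⌊ i ≟ j ⌋) *_) (disjoint-degree x)) ⟩
      ∑[ j ∈ is ] (𝟙 (not ⌊ i ≟ j ⌋) * P k)
        ≡⟨ ∑-≢ i (λ _ → P k) ⟩
      ∑[ _ ∈ is ] P k - P k
        ≡⟨ cong (_- P k) (trans (∑-const is (P k)) (cong (λ l → + l * P k) (length-allFin (suc m)))) ⟩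
      (1ℤ + M) * P k - P k
        ≡⟨ drop-one M (P k) ⟩
      M * P k
        ≡⟨ ℤ.pos-* m (m ^ k) ⟨
      P (suc k)
        ∎
      where
      open ≡-Reasoning
      is = allFin (suc m)
      xs = allTuples (suc m) k
      drop-one : ∀ M p → (1ℤ + M) * p - p ≡ M * p
      drop-one = solve-∀

    ⟪,W⟫-1ʳ : ∀ {k} (f : Fun k) → ⟪ f ,W (λ _ → 1ℤ) ⟫ ≡ P k * ∑ᵀ f
    ⟪,W⟫-1ʳ {k} f = begin
      ∑ᵀ (λ x → ∑ᵀ (λ y → 𝟙 (disjoint x y) * (f x * 1ℤ)))
        ≡⟨ ∑-cong xs (λ x → trans (∑-cong xs (λ y → swap (𝟙 (disjoint x y)) (f x)))
                                  (*-distribˡ-∑ xs (f x) _)) ⟩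
      ∑ᵀ (λ x → f x * ∑ᵀ (λ y → 𝟙 (disjoint x y)))
        ≡⟨ ∑-cong xs (λ x → trans (cong (f x *_) (disjoint-degree x)) (ℤ.*-comm (f x) (P k))) ⟩
      ∑ᵀ (λ x → P k * f x)
        ≡⟨ *-distribˡ-∑ xs (P k) f ⟩
      P k * ∑ᵀ f
        ∎
      where
      open ≡-Reasoning
      xs = allTuples (suc m) k
      swap : ∀ w a → w * (a * 1ℤ) ≡ a * w
      swap = solve-∀

    ⟪,W⟫-1ˡ : ∀ {k} (g : Fun k) → ⟪ (λ _ → 1ℤ) ,W g ⟫ ≡ P k * ∑ᵀ g
    ⟪,W⟫-1ˡ g = trans (⟪,W⟫-sym _ g) (⟪,W⟫-1ʳ g)

    0<length-allTuples : ∀ k → 0ℤ < + length (allTuples (suc m) k)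
    0<length-allTuples k = subst (0ℤ <_) (sym (length-allTuples k)) (ℤ.+<+ (ℕ.m^n>0 (suc m) k))

    i≤M*i : ∀ {i} → 0ℤ ≤ i → i ≤ M * i
    i≤M*i {i} 0≤i = subst (_≤ M * i) (ℤ.*-identityˡ i)
      (ℤ.*-monoʳ-≤-nonNeg i {{ℤ.nonNegative 0≤i}} (+≤+ (ℕ.>-nonZero⁻¹ m)))

    module Decomposition {k} (h : Fun (suc k)) where

      is : List (Fin (suc m))
      is = allFin (suc m)

      ℓ N : ℤ
      ℓ = + length is
      N = + length (allTuples (suc m) k)

      H : Fun k
      H = marginal h

      u : Fin (suc m) → Fun k
      u i x = ℓ * slice h i x - H x

      c : Fin (suc m) → ℤ
      c i = ∑ᵀ (u i)

      v : Fin (suc m) → Fun k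
      v i x = N * u i x - c i

      C : ℤ
      C = ∑[ i ∈ is ] (c i * c i)

      ⟪,W⟫-decomposition :
        ℓ * ℓ * (N * N) * (M * ⟪ h ,W h ⟫)
          ≡ ℓ * M * (N * N) * (M * ⟪ H ,W H ⟫) - M * (P k * N * C) - ∑[ i ∈ is ] (M * ⟪ v i ,W v i ⟫)
      ⟪,W⟫-decomposition = begin
        K * (M * ⟪ h ,W h ⟫)
          ≡⟨ cong (λ z → K * (M * z)) (⟪,W⟫-slices h) ⟩
        K * (M * (⟪ H ,W H ⟫ - ∑[ i ∈ is ] ⟪ slice h i ,W slice h i ⟫))
          ≡⟨ distrib K M ⟪ H ,W H ⟫ _ ⟩
        M * (K * ⟪ H ,W H ⟫) - M * (K * ∑[ i ∈ is ] ⟪ slice h i ,W slice h i ⟫)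
          ≡⟨ cong (λ z → M * (K * ⟪ H ,W H ⟫) - M * z)
                  (IsBilinear.decomposition ⟪,W⟫-bilinear is xs (P k) ⟪,W⟫-1ˡ ⟪,W⟫-1ʳ (slice h)) ⟩
        M * (K * ⟪ H ,W H ⟫) - M * (N * N * ℓ * ⟪ H ,W H ⟫ + P k * N * C + ∑[ i ∈ is ] ⟪ v i ,W v i ⟫)
          ≡⟨ regroup ℓ M N ⟪ H ,W H ⟫ (P k) C _ ⟩
        ℓ * (ℓ - 1ℤ) * (N * N) * (M * ⟪ H ,W H ⟫) - M * (P k * N * C) - M * ∑[ i ∈ is ] ⟪ v i ,W v i ⟫
          ≡⟨ cong₂ (λ l s → ℓ * (+ l - 1ℤ) * (N * N) * (M * ⟪ H ,W H ⟫) - M * (P k * N * C) - s)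
                   (length-allFin (suc m)) (sym (*-distribˡ-∑ is M (λ i → ⟪ v i ,W v i ⟫))) ⟩
        ℓ * M * (N * N) * (M * ⟪ H ,W H ⟫) - M * (P k * N * C) - ∑[ i ∈ is ] (M * ⟪ v i ,W v i ⟫)
          ∎
        where
        open ≡-Reasoning
        xs = allTuples (suc m) k
        K = ℓ * ℓ * (N * N)
        distrib : ∀ K M a b → K * (M * (a - b)) ≡ M * (K * a) - M * (K * b)
        distrib = solve-∀
        regroup : ∀ ℓ M N w p c s → M * (ℓ * ℓ * (N * N) * w) - M * (N * N * ℓ * w + p * N * c + s)
                                  ≡ ℓ * (ℓ - 1ℤ) * (N * N) * (M * w) - M * (p * N * c) - M * s
        regroup = solve-∀

      ⟪,⟫-decomposition :
        ℓ * ℓ * (N * N) * ⟪ h , h ⟫ ≡ N * N * ℓ * ⟪ H , H ⟫ + 1ℤ * N * C + ∑[ i ∈ is ] ⟪ v i , v i ⟫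
      ⟪,⟫-decomposition = trans (cong (ℓ * ℓ * (N * N) *_) (⟪,⟫-slices h))
        (IsBilinear.decomposition ⟪,⟫-bilinear is (allTuples (suc m) k) 1ℤ ⟪,⟫-1ˡ ⟪,⟫-1ʳ (slice h))

      ∑H≡0 : ∑ᵀ h ≡ 0ℤ → ∑ᵀ H ≡ 0ℤ
      ∑H≡0 = trans (sym (∑ᵀ-marginal h))

      ∑v≡0 : ∀ i → ∑ᵀ (v i) ≡ 0ℤ
      ∑v≡0 i = ∑-centred (allTuples (suc m) k) (u i)

      0<ℓℓNN : 0ℤ < ℓ * ℓ * (N * N)
      0<ℓℓNN = 0<i*j (0<i*j 0<ℓ 0<ℓ) (0<i*j (0<length-allTuples k) (0<length-allTuples k))
        where 0<ℓ = subst (0ℤ <_) (cong +_ (sym (length-allFin (suc m)))) (ℤ.+<+ (ℕ.s≤s ℕ.z≤n))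

    spectral-gap : ∀ k (h : Fun k) → ∑ᵀ h ≡ 0ℤ → ∣ M * ⟪ h ,W h ⟫ ∣ᶻ ≤ P k * ⟪ h , h ⟫
    spectral-gap zero h ∑h≡0 = begin
      ∣ M * ⟪ h ,W h ⟫ ∣ᶻ  ≡⟨ cong (λ a → ∣ M * (1ℤ * (a * a) + 0ℤ + 0ℤ) ∣ᶻ) h[]≡0 ⟩
      ∣ M * 0ℤ ∣ᶻ          ≡⟨ cong ∣_∣ᶻ (ℤ.*-zeroʳ M) ⟩
      0ℤ                   ≤⟨ 0≤i*j (0≤+ 1) (⟪,⟫-nonNeg h) ⟩
      P 0 * ⟪ h , h ⟫      ∎
      where
      open ℤ.≤-Reasoning
      h[]≡0 = trans (sym (ℤ.+-identityʳ (h []))) ∑h≡0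
    spectral-gap (suc k) h ∑h≡0 = ℤ.*-cancelˡ-≤-pos _ _ K {{ℤ.positive 0<ℓℓNN}} (begin
      K * ∣ M * ⟪ h ,W h ⟫ ∣ᶻ
        ≡⟨ ∣i*j∣ᶻ≡i*∣j∣ᶻ (M * ⟪ h ,W h ⟫) (ℤ.<⇒≤ 0<ℓℓNN) ⟨
      ∣ K * (M * ⟪ h ,W h ⟫) ∣ᶻ
        ≡⟨ cong ∣_∣ᶻ ⟪,W⟫-decomposition ⟩
      ∣ A * (M * ⟪ H ,W H ⟫) - M * (P k * N * C) - ∑[ i ∈ is ] (M * ⟪ v i ,W v i ⟫) ∣ᶻ
        ≤⟨ ∣a*x-b-∑∣ᶻ≤ is 0≤A 0≤MPNC (M * ⟪ H ,W H ⟫) (λ i → M * ⟪ v i ,W v i ⟫) ⟩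
      A * ∣ M * ⟪ H ,W H ⟫ ∣ᶻ + M * (P k * N * C) + ∑[ i ∈ is ] ∣ M * ⟪ v i ,W v i ⟫ ∣ᶻ
        ≤⟨ ℤ.+-mono-≤
             (ℤ.+-monoˡ-≤ _ (ℤ.*-monoˡ-≤-nonNeg A {{ℤ.nonNegative 0≤A}} (spectral-gap k H (∑H≡0 ∑h≡0))))
             (∑-mono-≤ is (λ i → spectral-gap k (v i) (∑v≡0 i))) ⟩
      A * (P k * ⟪ H , H ⟫) + M * (P k * N * C) + ∑[ i ∈ is ] (P k * ⟪ v i , v i ⟫)
        ≤⟨ ℤ.+-monoʳ-≤ (A * (P k * ⟪ H , H ⟫) + M * (P k * N * C)) ∑v-bound ⟩
      A * (P k * ⟪ H , H ⟫) + M * (P k * N * C) + M * (P k * ∑[ i ∈ is ] ⟪ v i , v i ⟫)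
        ≡⟨ regroup ℓ M N (P k) ⟪ H , H ⟫ C _ ⟩
      M * P k * (N * N * ℓ * ⟪ H , H ⟫ + 1ℤ * N * C + ∑[ i ∈ is ] ⟪ v i , v i ⟫)
        ≡⟨ cong (M * P k *_) ⟪,⟫-decomposition ⟨
      M * P k * (K * ⟪ h , h ⟫)
        ≡⟨ rotate (M * P k) K ⟪ h , h ⟫ ⟩
      K * (M * P k * ⟪ h , h ⟫)
        ≡⟨ cong (λ p → K * (p * ⟪ h , h ⟫)) (ℤ.pos-* m (m ^ k)) ⟨
      K * (P (suc k) * ⟪ h , h ⟫)
        ∎)
      where
      open ℤ.≤-Reasoning
      open Decomposition h
      K = ℓ * ℓ * (N * N)
      A = ℓ * M * (N * N)
      0≤A : 0ℤ ≤ A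
      0≤A = 0≤i*j (0≤i*j (0≤+ (length is)) (0≤+ m)) (0≤i*j (0≤+ (length (allTuples (suc m) k))) (0≤+ _))
      0≤MPNC : 0ℤ ≤ M * (P k * N * C)
      0≤MPNC = 0≤i*j (0≤+ m) (0≤i*j (0≤i*j (0≤+ (m ^ k)) (0≤+ (length (allTuples (suc m) k))))
                                   (∑-nonNeg is (λ i → 0≤i*i (c i))))
      ∑v-bound : ∑[ i ∈ is ] (P k * ⟪ v i , v i ⟫) ≤ M * (P k * ∑[ i ∈ is ] ⟪ v i , v i ⟫)
      ∑v-bound = subst (_≤ M * (P k * ∑[ i ∈ is ] ⟪ v i , v i ⟫)) (sym (*-distribˡ-∑ is (P k) _))
        (i≤M*i (0≤i*j (0≤+ (m ^ k)) (∑-nonNeg is (λ i → ⟪,⟫-nonNeg (v i)))))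
      regroup : ∀ ℓ M N p w c s → ℓ * M * (N * N) * (p * w) + M * (p * N * c) + M * (p * s)
                                ≡ M * p * (N * N * ℓ * w + 1ℤ * N * c + s)
      regroup = solve-∀
      rotate : ∀ a K b → a * (K * b) ≡ K * (a * b)
      rotate = solve-∀

    deviation-bound : ∀ k (g : Fun k) → let N = + length (allTuples (suc m) k) ; a = ∑ᵀ g in
      ∣ M * (N * ⟪ g ,W g ⟫ - P k * (a * a)) ∣ᶻ ≤ P k * (N * ⟪ g , g ⟫ - a * a)
    deviation-bound k g = ℤ.*-cancelˡ-≤-pos _ _ N {{ℤ.positive (0<length-allTuples k)}} (begin
      N * ∣ M * (N * ⟪ g ,W g ⟫ - P k * (a * a)) ∣ᶻ
        ≡⟨ ∣i*j∣ᶻ≡i*∣j∣ᶻ _ (0≤+ (length xs)) ⟨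
      ∣ N * (M * (N * ⟪ g ,W g ⟫ - P k * (a * a))) ∣ᶻ
        ≡⟨ cong ∣_∣ᶻ (regroupᵂ N M ⟪ g ,W g ⟫ (P k) a) ⟩
      ∣ M * (N * N * ⟪ g ,W g ⟫ - P k * N * (a * a)) ∣ᶻ
        ≡⟨ cong (λ z → ∣ M * z ∣ᶻ) (IsBilinear.centre-constant ⟪,W⟫-bilinear xs (P k) ⟪,W⟫-1ˡ ⟪,W⟫-1ʳ g) ⟨
      ∣ M * ⟪ h ,W h ⟫ ∣ᶻ
        ≤⟨ spectral-gap k h (∑-centred xs g) ⟩
      P k * ⟪ h , h ⟫
        ≡⟨ cong (P k *_) (IsBilinear.centre-constant ⟪,⟫-bilinear xs 1ℤ ⟪,⟫-1ˡ ⟪,⟫-1ʳ g) ⟩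
      P k * (N * N * ⟪ g , g ⟫ - 1ℤ * N * (a * a))
        ≡⟨ regroup N (P k) ⟪ g , g ⟫ a ⟩
      N * (P k * (N * ⟪ g , g ⟫ - a * a))
        ∎)
      where
      open ℤ.≤-Reasoning
      xs = allTuples (suc m) k
      N = + length xs
      a = ∑ᵀ g
      h = λ x → N * g x - a
      regroupᵂ : ∀ N M w p a → N * (M * (N * w - p * (a * a))) ≡ M * (N * N * w - p * N * (a * a))
      regroupᵂ = solve-∀
      regroup : ∀ N p b a → p * (N * N * b - 1ℤ * N * (a * a)) ≡ N * (p * (N * b - a * a))
      regroup = solve-∀

    module _ {k} (G : Tuple (suc m) k → Bool) where

      private
        g : Fun k
        g x = 𝟙 (G x)

      indicator-deviation-bound : ∀ {N a q} →
        + length (allTuples (suc m) k) ≡ N → ∑ᵀ g ≡ a → ⟪ g ,W g ⟫ ≡ q →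
        ∣ M * (N * q - P k * (a * a)) ∣ᶻ ≤ P k * (N * a - a * a)
      indicator-deviation-bound refl refl refl =
        subst (λ b → ∣ M * (N * ⟪ g ,W g ⟫ - P k * (∑ᵀ g * ∑ᵀ g)) ∣ᶻ ≤ P k * (N * b - ∑ᵀ g * ∑ᵀ g))
          (∑-cong (allTuples (suc m) k) (λ x → 𝟙-idem (G x))) (deviation-bound k g)
        where
        N = + length (allTuples (suc m) k)
        𝟙-idem : ∀ b → 𝟙 b * 𝟙 b ≡ 𝟙 b
        𝟙-idem true  = refl
        𝟙-idem false = refl

      complement-pairs : ⟪ (λ x → 𝟙 (not (G x))) ,W g ⟫ ≡ P k * ∑ᵀ g - ⟪ g ,W g ⟫
      complement-pairs = begin
        ⟪ (λ x → 𝟙 (not (G x))) ,W g ⟫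
          ≡⟨ L-cong (linearˡ g) (λ x → 𝟙-not (G x)) ⟩
        ⟪ (λ x → 1ℤ * 1ℤ + -1ℤ * g x) ,W g ⟫
          ≡⟨ linear (linearˡ g) 1ℤ -1ℤ (λ _ → 1ℤ) g ⟩
        1ℤ * ⟪ (λ _ → 1ℤ) ,W g ⟫ + -1ℤ * ⟪ g ,W g ⟫
          ≡⟨ cong (λ z → 1ℤ * z + -1ℤ * ⟪ g ,W g ⟫) (⟪,W⟫-1ˡ g) ⟩
        1ℤ * (P k * ∑ᵀ g) + -1ℤ * ⟪ g ,W g ⟫
          ≡⟨ tidy (P k * ∑ᵀ g) ⟪ g ,W g ⟫ ⟩
        P k * ∑ᵀ g - ⟪ g ,W g ⟫
          ∎
        where
        open ≡-Reasoning
        open IsBilinear ⟪,W⟫-bilinear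
        open IsLinear
        𝟙-not : ∀ b → 𝟙 (not b) ≡ 1ℤ * 1ℤ + -1ℤ * 𝟙 b
        𝟙-not true  = refl
        𝟙-not false = refl
        tidy : ∀ a b → 1ℤ * a + -1ℤ * b ≡ a - b
        tidy = solve-∀

    length-disjointPairs : ∀ k → + length (disjointPairs (suc m) k) ≡ P k * + length (allTuples (suc m) k)
    length-disjointPairs k = begin
      + length (disjointPairs (suc m) k)        ≡⟨ length-∑ (disjointPairs (suc m) k) ⟩
      ∑ (disjointPairs (suc m) k) (λ _ → 1ℤ)    ≡⟨ ∑-disjointPairs {k} (λ _ → 1ℤ) ⟩
      ⟪_,W_⟫ {k} (λ _ → 1ℤ) (λ _ → 1ℤ)          ≡⟨ ⟪,W⟫-1ʳ {k} (λ _ → 1ℤ) ⟩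
      P k * ∑ᵀ {k} (λ _ → 1ℤ)                   ≡⟨ cong (P k *_) (length-∑ (allTuples (suc m) k)) ⟨
      P k * + length (allTuples (suc m) k)      ∎
      where open ≡-Reasoning

    nonZero-length-disjointPairs : ∀ k → ℕ.NonZero (length (disjointPairs (suc m) k))
    nonZero-length-disjointPairs k = ℕ.>-nonZero (ℤ.drop‿+<+ (subst (0ℤ <_) (sym (length-disjointPairs k))
      (0<i*j (ℤ.+<+ (ℕ.m^n>0 m k)) (0<length-allTuples k))))

  module _ (q a P : ℤ) {T₀ N₀ M₀ : ℕ} (T≡PN : + suc T₀ ≡ P * + suc N₀)
           (deviation : ∣ + suc M₀ * (+ suc N₀ * q - P * (a * a)) ∣ᶻ ≤ P * (+ suc N₀ * a - a * a)) where

    private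
      N T M : ℤ
      N = + suc N₀
      T = + suc T₀
      M = + suc M₀

      α : ℚᵘ.ℚᵘ
      α = ℚᵘ.mkℚᵘ a N₀

      D B : ℤ
      D = N * q - P * (a * a)
      B = N * a - a * a

      cleared : ∀ U → ∣ U ∣ᶻ ≡ ∣ N * D ∣ᶻ → ∣ U ∣ᶻ * (N * (1ℤ * N) * M) ≤ N * N * N * (P * B)
      cleared U ∣U∣≡∣ND∣ = begin
        ∣ U ∣ᶻ * (N * (1ℤ * N) * M)
          ≡⟨ cong (_* (N * (1ℤ * N) * M)) (trans ∣U∣≡∣ND∣ (∣i*j∣ᶻ≡i*∣j∣ᶻ D (0≤+ (suc N₀)))) ⟩
        N * ∣ D ∣ᶻ * (N * (1ℤ * N) * M)
          ≡⟨ regroup N ∣ D ∣ᶻ M ⟩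
        N * N * N * (M * ∣ D ∣ᶻ)
          ≡⟨ cong (N * N * N *_) (∣i*j∣ᶻ≡i*∣j∣ᶻ D (0≤+ (suc M₀))) ⟨
        N * N * N * ∣ M * D ∣ᶻ
          ≤⟨ ℤ.*-monoˡ-≤-nonNeg (N * N * N) deviation ⟩
        N * N * N * (P * B)
          ∎
        where
        open ℤ.≤-Reasoning
        regroup : ∀ N d M → N * d * (N * (1ℤ * N) * M) ≡ N * N * N * (M * d)
        regroup = solve-∀

      cleared-bound : N * N * N * (P * B) ≡ a * (1ℤ * N + - a * 1ℤ) * 1ℤ * (T * (N * N))
      cleared-bound =
        trans (regroup N P a) (cong (λ t → a * (1ℤ * N + - a * 1ℤ) * 1ℤ * (t * (N * N))) (sym T≡PN))
        where
        regroup : ∀ N P a → N * N * N * (P * (N * a - a * a))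
                          ≡ a * (1ℤ * N + - a * 1ℤ) * 1ℤ * (P * N * (N * N))
        regroup = solve-∀

    -- `ℚᵘ.*≤*` reduces each bound to an inequality between cross-multiplied integers; the first line of
    -- each chain is that unfolding, for the fractions q / T, α = a / N and 1 / M.
    A₁∩A₂-boundᵘ : ℚᵘ.∣ ℚᵘ.mkℚᵘ q T₀ ℚᵘ.- α ℚᵘ.* α ∣ ℚᵘ.≤ α ℚᵘ.* (ℚᵘ.1ℚᵘ ℚᵘ.- α) ℚᵘ.* ℚᵘ.mkℚᵘ 1ℤ M₀
    A₁∩A₂-boundᵘ = ℚᵘ.*≤* (begin
      ∣ q * (N * N) + - (a * a) * T ∣ᶻ * (N * (1ℤ * N) * M)
        ≤⟨ cleared (q * (N * N) + - (a * a) * T) (cong ∣_∣ᶻ numerator) ⟩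
      N * N * N * (P * B)
        ≡⟨ cleared-bound ⟩
      a * (1ℤ * N + - a * 1ℤ) * 1ℤ * (T * (N * N))
        ∎)
      where
      open ℤ.≤-Reasoning
      numerator : q * (N * N) + - (a * a) * T ≡ N * D
      numerator = trans (cong (λ t → q * (N * N) + - (a * a) * t) T≡PN) (regroup q a P N)
        where
        regroup : ∀ q a P N → q * (N * N) + - (a * a) * (P * N) ≡ N * (N * q - P * (a * a))
        regroup = solve-∀

    Ā₁∩A₂-boundᵘ : ∀ {q′} → q′ ≡ P * a - q →
      ℚᵘ.∣ ℚᵘ.mkℚᵘ q′ T₀ ℚᵘ.- α ℚᵘ.* (ℚᵘ.1ℚᵘ ℚᵘ.- α) ∣ ℚᵘ.≤ α ℚᵘ.* (ℚᵘ.1ℚᵘ ℚᵘ.- α) ℚᵘ.* ℚᵘ.mkℚᵘ 1ℤ M₀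
    Ā₁∩A₂-boundᵘ {q′} q′≡ = ℚᵘ.*≤* (begin
      ∣ U ∣ᶻ * (N * (1ℤ * N) * M)
        ≤⟨ cleared U (trans (cong ∣_∣ᶻ numerator) (cong +_ (ℤ.∣-i∣≡∣i∣ (N * D)))) ⟩
      N * N * N * (P * B)
        ≡⟨ trans cleared-bound
                 (cong (λ z → a * (1ℤ * N + - a * 1ℤ) * 1ℤ * (T * (N * z))) (sym (ℤ.*-identityˡ N))) ⟩
      a * (1ℤ * N + - a * 1ℤ) * 1ℤ * (T * (N * (1ℤ * N)))
        ∎)
      where
      open ℤ.≤-Reasoning
      U = q′ * (N * (1ℤ * N)) + - (a * (1ℤ * N + - a * 1ℤ)) * T
      numerator : U ≡ - (N * D)
      numerator = trans (cong₂ (λ r t → r * (N * (1ℤ * N)) + - (a * (1ℤ * N + - a * 1ℤ)) * t) q′≡ T≡PN)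
                        (regroup q a P N)
        where
        regroup : ∀ q a P N → (P * a - q) * (N * (1ℤ * N)) + - (a * (1ℤ * N + - a * 1ℤ)) * (P * N)
                            ≡ - (N * (N * q - P * (a * a)))
        regroup = solve-∀

  module _ {p q : ℚ.ℚ} {p′ q′ : ℚᵘ.ℚᵘ} where

    toℚᵘ-* : ℚ.toℚᵘ p ℚᵘ.≃ p′ → ℚ.toℚᵘ q ℚᵘ.≃ q′ → ℚ.toℚᵘ (p ℚ.* q) ℚᵘ.≃ p′ ℚᵘ.* q′
    toℚᵘ-* p≃ q≃ = ℚᵘ.≃-trans (ℚ.toℚᵘ-homo-* p q) (ℚᵘ.*-cong p≃ q≃)

    toℚᵘ-minus : ℚ.toℚᵘ p ℚᵘ.≃ p′ → ℚ.toℚᵘ q ℚᵘ.≃ q′ → ℚ.toℚᵘ (p ℚ.- q) ℚᵘ.≃ p′ ℚᵘ.- q′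
    toℚᵘ-minus p≃ q≃ =
      ℚᵘ.≃-trans (ℚ.toℚᵘ-homo-+ p (ℚ.- q)) (ℚᵘ.+-cong p≃ (ℚᵘ.≃-trans (ℚ.toℚᵘ-homo‿- q) (ℚᵘ.-‿cong q≃)))

    ≤-via-toℚᵘ : ℚ.toℚᵘ p ℚᵘ.≃ p′ → ℚ.toℚᵘ q ℚᵘ.≃ q′ → p′ ℚᵘ.≤ q′ → p ℚ.≤ q
    ≤-via-toℚᵘ p≃ q≃ p′≤q′ =
      ℚ.toℚᵘ-cancel-≤ (ℚᵘ.≤-respˡ-≃ (ℚᵘ.≃-sym p≃) (ℚᵘ.≤-respʳ-≃ (ℚᵘ.≃-sym q≃) p′≤q′))

  toℚᵘ-∣∣ : ∀ {p p′} → ℚ.toℚᵘ p ℚᵘ.≃ p′ → ℚ.toℚᵘ ℚ.∣ p ∣ ℚᵘ.≃ ℚᵘ.∣ p′ ∣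
  toℚᵘ-∣∣ {p} p≃ = ℚᵘ.≃-trans (ℚ.toℚᵘ-homo-∣-∣ p) (ℚᵘ.∣-∣-cong p≃)

  toℚᵘ-complement : ∀ {p p′} → ℚ.toℚᵘ p ℚᵘ.≃ p′ → ℚ.toℚᵘ (ℚ.1ℚ ℚ.- p) ℚᵘ.≃ ℚᵘ.1ℚᵘ ℚᵘ.- p′
  toℚᵘ-complement {p} = toℚᵘ-minus {ℚ.1ℚ} {p} ℚᵘ.≃-refl

  toℚᵘ-ratio : ∀ a d → ℚ.toℚᵘ (ratio a (suc d)) ℚᵘ.≃ ℚᵘ.mkℚᵘ (+ a) d
  toℚᵘ-ratio a d = ℚ.toℚᵘ-fromℚᵘ (ℚᵘ.mkℚᵘ (+ a) d)

  toℚᵘ-bound : ∀ a N₀ M₀ → let α = ratio a (suc N₀) ; αᵘ = ℚᵘ.mkℚᵘ (+ a) N₀ in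
    ℚ.toℚᵘ (α ℚ.* (ℚ.1ℚ ℚ.- α) ℚ.* ratio 1 (suc M₀)) ℚᵘ.≃ αᵘ ℚᵘ.* (ℚᵘ.1ℚᵘ ℚᵘ.- αᵘ) ℚᵘ.* ℚᵘ.mkℚᵘ 1ℤ M₀
  toℚᵘ-bound a N₀ M₀ =
    toℚᵘ-* (toℚᵘ-* (toℚᵘ-ratio a N₀) (toℚᵘ-complement (toℚᵘ-ratio a N₀))) (toℚᵘ-ratio 1 M₀)

  A₁∩A₂-bound : ∀ q a (P : ℤ) T N M .{{_ : ℕ.NonZero T}} .{{_ : ℕ.NonZero N}} .{{_ : ℕ.NonZero M}} →
    + T ≡ P * + N → ∣ + M * (+ N * + q - P * (+ a * + a)) ∣ᶻ ≤ P * (+ N * + a - + a * + a) →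
    let α = ratio a N in ℚ.∣ ratio q T ℚ.- α ℚ.* α ∣ ℚ.≤ α ℚ.* (ℚ.1ℚ ℚ.- α) ℚ.* ratio 1 M
  A₁∩A₂-bound q a P (suc T₀) (suc N₀) (suc M₀) T≡PN deviation =
    ≤-via-toℚᵘ
      (toℚᵘ-∣∣ (toℚᵘ-minus (toℚᵘ-ratio q T₀) (toℚᵘ-* (toℚᵘ-ratio a N₀) (toℚᵘ-ratio a N₀))))
      (toℚᵘ-bound a N₀ M₀) (A₁∩A₂-boundᵘ (+ q) (+ a) P T≡PN deviation)

  Ā₁∩A₂-bound : ∀ q q′ a (P : ℤ) T N M .{{_ : ℕ.NonZero T}} .{{_ : ℕ.NonZero N}} .{{_ : ℕ.NonZero M}} →
    + T ≡ P * + N → ∣ + M * (+ N * + q - P * (+ a * + a)) ∣ᶻ ≤ P * (+ N * + a - + a * + a) →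
    + q′ ≡ P * + a - + q →
    let α = ratio a N in ℚ.∣ ratio q′ T ℚ.- α ℚ.* (ℚ.1ℚ ℚ.- α) ∣ ℚ.≤ α ℚ.* (ℚ.1ℚ ℚ.- α) ℚ.* ratio 1 M
  Ā₁∩A₂-bound q q′ a P (suc T₀) (suc N₀) (suc M₀) T≡PN deviation q′≡ =
    ≤-via-toℚᵘ
      (toℚᵘ-∣∣ (toℚᵘ-minus (toℚᵘ-ratio q′ T₀) (toℚᵘ-* (toℚᵘ-ratio a N₀) (toℚᵘ-complement (toℚᵘ-ratio a N₀)))))
      (toℚᵘ-bound a N₀ M₀) (Ā₁∩A₂-boundᵘ (+ q) (+ a) P T≡PN deviation q′≡)

open import Defs
open import Data.Nat using (ℕ; _≤_; _^_; _∸_)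
open import Data.Rational using (ℚ; _*_; _-_; 1ℚ; ∣_∣) renaming (_≤_ to _≤ℚ_)
open import Data.Bool using (Bool; _∧_; not)
open import Data.Product using (_×_; _,_)

open import Data.Nat using (zero; suc; s≤s)
import Data.Nat as ℕ
import Data.Nat.Properties as ℕ
import Data.Integer as ℤ
open import Data.List using (length)
open import Relation.Binary.PropositionalEquality using (_≡_; sym; trans; cong; cong₂)

proposition2 : (n k : ℕ) → 2 ≤ n → 1 ≤ k → (G : Tuple n k → Bool) →
    let α = ratio (count G (allTuples n k)) (n ^ k) in
    (∣ Pr n k (λ { (s₁ , s₂) → G s₁ ∧ G s₂ }) - α * α ∣ ≤ℚ (α * (1ℚ - α)) * ratio 1 (n ∸ 1))
    × (∣ Pr n k (λ { (s₁ , s₂) → not (G s₁) ∧ G s₂ }) - α * (1ℚ - α) ∣ ≤ℚ (α * (1ℚ - α)) * ratio 1 (n ∸ 1))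
proposition2 zero          k ()       _ G
proposition2 (suc zero)    k (s≤s ()) _ G
proposition2 (suc (suc p)) k _        _ G =
    A₁∩A₂-bound q₁ a (P k) (length (disjointPairs n k)) (n ^ k) (suc p) T≡PN deviation
  , Ā₁∩A₂-bound q₁ q₂ a (P k) (length (disjointPairs n k)) (n ^ k) (suc p) T≡PN deviation q₂≡
  where
  open Forms (suc (suc p))
  open SpectralGap (suc p)

  n a q₁ q₂ : ℕ
  n = suc (suc p)
  a = count G (allTuples n k)
  q₁ = count (λ { (s₁ , s₂) → G s₁ ∧ G s₂ }) (disjointPairs n k)
  q₂ = count (λ { (s₁ , s₂) → not (G s₁) ∧ G s₂ }) (disjointPairs n k)

  g : Fun k
  g x = 𝟙 (G x)

  instance
    n^k≢0 : ℕ.NonZero (n ^ k)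
    n^k≢0 = ℕ.m^n≢0 n k
    disjointPairs≢0 : ℕ.NonZero (length (disjointPairs n k))
    disjointPairs≢0 = nonZero-length-disjointPairs k

  a≡ : ∑ᵀ g ≡ ℤ.+ a
  a≡ = sym (count-∑ G (allTuples n k))

  q₁≡ : ⟪ g ,W g ⟫ ≡ ℤ.+ q₁
  q₁≡ = sym (count-disjointPairs _ g g (λ x y → 𝟙-∧ (G x) (G y)))

  q₂≡ : ℤ.+ q₂ ≡ P k ℤ.* ℤ.+ a ℤ.- ℤ.+ q₁
  q₂≡ = trans (count-disjointPairs _ (λ x → 𝟙 (not (G x))) g (λ x y → 𝟙-∧ (not (G x)) (G y)))
              (trans (complement-pairs G) (cong₂ (λ s w → P k ℤ.* s ℤ.- w) a≡ q₁≡))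

  T≡PN : ℤ.+ length (disjointPairs n k) ≡ P k ℤ.* ℤ.+ (n ^ k)
  T≡PN = trans (length-disjointPairs k) (cong (P k ℤ.*_) (length-allTuples k))

  deviation : ∣ M ℤ.* (ℤ.+ (n ^ k) ℤ.* ℤ.+ q₁ ℤ.- P k ℤ.* (ℤ.+ a ℤ.* ℤ.+ a)) ∣ᶻ
                ℤ.≤ P k ℤ.* (ℤ.+ (n ^ k) ℤ.* ℤ.+ a ℤ.- ℤ.+ a ℤ.* ℤ.+ a)
  deviation = indicator-deviation-bound G (length-allTuples k) a≡ q₁≡
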